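{- Let $\omega=\frac{ -1+\sqrt{ -3}}{2}$ and define the Lehmer-Euler numbers $W_n$ by $$\sum_{n=0}^\infty W_n\frac{t^n}{n!}=\frac{3}{e^{t}+e^{\omega t}+e^{\omega^2 t}}=\left(\sum_{l=0}^\infty\frac{t^{3l}}{(3l)!}\right)^{ -1}.$$ Then for every non-negative integer $n$, $W_{3n}\in\mathbb{Z}$ and $W_{3n}\equiv(-1)^n\pmod 9$. -}

module Defs where

open import Data.Nat using (ℕ; zero; suc; _!; _%_)
open import Data.Nat.Properties using (_!≢0)
open import Data.Integer using (ℤ; +_)
open import Data.Rational using (ℚ; _/_; _*_; -_; 0ℚ; 1ℚ)
open import Data.List using (List; []; _∷_; zipWith; map; applyUpTo; sum)
open import Data.List using (foldr)
open import Data.Rational using (_+_)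

c : ℕ → ℚ
c k with k % 3
... | zero  = ((+ 1) / (k !)) {{k !≢0}}
... | suc _ = 0ℚ

-- Coefficients a_n of the formal power series inverse  1 / C(t) = Σ a_n t^n.
-- Since c 0 = 1, the inverse is determined by
--   a_0 = 1,   a_n = - Σ_{k=1}^{n} c_k · a_{n-k}   (n ≥ 1),
-- i.e. by the Cauchy-product identity C(t) · (Σ a_n t^n) = 1.
-- invList n = [a_n, a_{n-1}, …, a_0].
invList : ℕ → List ℚ
invList zero = 1ℚ ∷ []
invList (suc n) = next ∷ prev
  where
  prev : List ℚ
  prev = invList n
  next : ℚ
  next = - foldr _+_ 0ℚ (zipWith _*_ (applyUpTo (λ i → c (suc i)) (suc n)) prev)

a : ℕ → ℚ
a n with invList n
... | x ∷ _ = x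
... | []    = 0ℚ

-- Lehmer–Euler numbers:  Σ W_n t^n / n! = 3/(e^t + e^{ωt} + e^{ω²t}) = C(t)^{-1},
-- so W_n = n! · a_n.
W : ℕ → ℚ
W n = ((+ (n !)) / 1) * a n

-- Write f ⋆ g for the binomial convolution of integer sequences (the product of exponential
-- generating functions) and ∂ for the shift (their derivative), and let χ₃, χ₃⁻ be the
-- coefficient sequences of C(t) and C(-t). The integers w n defined by χ₃ ⋆ w = 1, 0, 0, …
-- equal W n, because (n+1)! = (n+1 C k+1) (k+1)! (n-k)! turns the recursion for a n into the
-- one for w n. As χ₃⁻ (3n) = (-1)ⁿ, it suffices to show w ≡ χ₃⁻ (mod 9), and since χ₃ 0 = 1
-- this follows once 9 divides χ₃ ⋆ (w - χ₃⁻), i.e. every positive-degree coefficient of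
-- C(t) C(-t). From C''' = C and C(-t)''' = -C(-t) the third-order Leibniz rule gives
-- (C(t) C(-t))''' = 3 (C'' C(-t)' + C' C(-t)''); the factors on the right have the same
-- (anti)periodicity, so applying it twice yields a factor 9 in every degree ≥ 6. Degrees 1
-- to 5 are checked by computation.
module Submission where

open import Algebra.Bundles using (Semiring; Ring)
open import Data.Fin.Base using (Fin; zero; suc; toℕ; inject₁; fromℕ)
open import Data.Fin.Properties using (toℕ<n; toℕ-inject₁; toℕ-fromℕ)
open import Data.List.Base using (List; []; _∷_; foldr; zipWith; applyUpTo; applyDownFrom)
open import Data.Nat.Base as ℕ using (ℕ; zero; suc; _∸_; _<_; _!; z<s)
open import Data.Nat.Combinatorics using (_C_)
open import Data.Nat.Induction using (<-rec)
open import Data.Vec.Functional using (Vector)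
open import Function.Base using (_∘_)
open import Relation.Binary.PropositionalEquality
  using (_≡_; refl; sym; trans; cong; cong₂; subst; _≗_; module ≡-Reasoning)

open import Defs

module _ {ℓ₁ ℓ₂} (R : Semiring ℓ₁ ℓ₂) where

  open Semiring R using (_≈_; _+_; _*_; 0#; +-congˡ) renaming (refl to ≈-refl)
  open import Algebra.Properties.Semiring.Sum R using (sum)

  foldr-zipWith-applyUpTo-applyDownFrom : ∀ f g n →
    foldr _+_ 0# (zipWith _*_ (applyUpTo f n) (applyDownFrom g n)) ≈
    sum {n} (λ i → f (toℕ i) * g (n ∸ suc (toℕ i)))
  foldr-zipWith-applyUpTo-applyDownFrom f g zero    = ≈-refl
  foldr-zipWith-applyUpTo-applyDownFrom f g (suc n) =
    +-congˡ (foldr-zipWith-applyUpTo-applyDownFrom (f ∘ suc) g n)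

module BinomialConvolution where

  open import Data.Integer.Base using (ℤ; +_; -_; _+_; _*_; _-_; 0ℤ; -1ℤ)
  open import Data.Integer.Properties
    using (+-*-semiring; +-commutativeSemigroup; +-identityʳ; *-identityˡ; *-distribʳ-+; pos-+; -1*i≡-i)
  open import Data.Integer.Divisibility.Signed
    using (_∣_; divides; ∣m∣n⇒∣m+n; ∣m+n∣n⇒∣m; ∣n⇒∣m*n)
  open import Data.Integer.Tactic.RingSolver using (solve-∀)
  open import Data.Nat.Combinatorics using (nCk+nC[k+1]≡[n+1]C[k+1]; k>n⇒nCk≡0)
  open import Data.Nat.Properties using (n<1+n; +-∸-assoc; ∸-monoʳ-<)
  open import Algebra.Properties.Semiring.Sum +-*-semiring
    using (sum; sum-cong-≗; ∑-distrib-+; *-distribˡ-sum; sum-init-last)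
  open import Algebra.Properties.CommutativeSemigroup +-commutativeSemigroup using (x∙yz≈y∙xz)
  open ≡-Reasoning

  ⋆-summand : (ℕ → ℤ) → (ℕ → ℤ) → (n : ℕ) → Vector ℤ (suc n)
  ⋆-summand f g n k = + (n C toℕ k) * (f (toℕ k) * g (n ∸ toℕ k))

  infixl 7 _⋆_

  _⋆_ : (ℕ → ℤ) → (ℕ → ℤ) → ℕ → ℤ
  (f ⋆ g) n = sum (⋆-summand f g n)

  ∂ : (ℕ → ℤ) → ℕ → ℤ
  ∂ f k = f (suc k)

  ∂³ : (ℕ → ℤ) → ℕ → ℤ
  ∂³ = ∂ ∘ ∂ ∘ ∂

  ⋆-cong : ∀ {f f′ g g′} → f ≗ f′ → g ≗ g′ → ∀ n → (f ⋆ g) n ≡ (f′ ⋆ g′) n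
  ⋆-cong {f} {f′} {g} {g′} f≗f′ g≗g′ n =
    sum-cong-≗ {suc n} {⋆-summand f g n} {⋆-summand f′ g′ n} λ k →
      cong₂ (λ x y → + (n C toℕ k) * (x * y)) (f≗f′ (toℕ k)) (g≗g′ (n ∸ toℕ k))

  ⋆-negʳ : ∀ f g n → (f ⋆ (-_ ∘ g)) n ≡ - (f ⋆ g) n
  ⋆-negʳ f g n = begin
    (f ⋆ (-_ ∘ g)) n  ≡⟨ sum-cong-≗ {suc n} {⋆-summand f (-_ ∘ g) n} {negated} pull-sign ⟩
    sum negated       ≡⟨ *-distribˡ-sum -1ℤ (⋆-summand f g n) ⟨
    -1ℤ * (f ⋆ g) n   ≡⟨ -1*i≡-i _ ⟩
    - (f ⋆ g) n       ∎
    where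
    negated : Vector ℤ (suc n)
    negated k = -1ℤ * ⋆-summand f g n k
    pull-sign : ⋆-summand f (-_ ∘ g) n ≗ negated
    pull-sign k = ring-identity (+ (n C toℕ k)) (f (toℕ k)) (g (n ∸ toℕ k))
      where
      ring-identity : ∀ b x y → b * (x * - y) ≡ -1ℤ * (b * (x * y))
      ring-identity = solve-∀

  ⋆-minusʳ : ∀ f g h n → (f ⋆ (λ k → g k - h k)) n ≡ (f ⋆ g) n - (f ⋆ h) n
  ⋆-minusʳ f g h n = begin
    (f ⋆ (λ k → g k - h k)) n      ≡⟨ sum-cong-≗ {suc n} {⋆-summand f (λ k → g k - h k) n} {summands} split ⟩
    sum summands                   ≡⟨ ∑-distrib-+ (⋆-summand f g n) (⋆-summand f (-_ ∘ h) n) ⟩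
    (f ⋆ g) n + (f ⋆ (-_ ∘ h)) n   ≡⟨ cong (λ s → (f ⋆ g) n + s) (⋆-negʳ f h n) ⟩
    (f ⋆ g) n - (f ⋆ h) n          ∎
    where
    summands : Vector ℤ (suc n)
    summands k = ⋆-summand f g n k + ⋆-summand f (-_ ∘ h) n k
    split : ⋆-summand f (λ k → g k - h k) n ≗ summands
    split k = ring-identity (+ (n C toℕ k)) (f (toℕ k)) (g (n ∸ toℕ k)) (h (n ∸ toℕ k))
      where
      ring-identity : ∀ b x y z → b * (x * (y - z)) ≡ b * (x * y) + b * (x * - z)
      ring-identity = solve-∀

  -- The dropped summand has the coefficient n C (n + 1) = 0.
  ∑-C-suc-drop-last : ∀ n (u : ℕ → ℤ) →
    sum {suc n} (λ k → + (n C suc (toℕ k)) * u (toℕ k)) ≡ sum {n} (λ k → + (n C suc (toℕ k)) * u (toℕ k))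
  ∑-C-suc-drop-last n u = begin
    sum {suc n} (term ∘ toℕ)                               ≡⟨ sum-init-last {n} (term ∘ toℕ) ⟩
    sum {n} (term ∘ toℕ ∘ inject₁) + term (toℕ (fromℕ n))  ≡⟨ cong₂ _+_ init≡ last≡0 ⟩
    sum {n} (term ∘ toℕ) + 0ℤ                              ≡⟨ +-identityʳ _ ⟩
    sum {n} (term ∘ toℕ)                                   ∎
    where
    term : ℕ → ℤ
    term k = + (n C suc k) * u k
    init≡ : sum {n} (term ∘ toℕ ∘ inject₁) ≡ sum {n} (term ∘ toℕ)
    init≡ = sum-cong-≗ {n} {term ∘ toℕ ∘ inject₁} {term ∘ toℕ} (cong term ∘ toℕ-inject₁)
    last≡0 : term (toℕ (fromℕ n)) ≡ 0ℤ
    last≡0 = trans (cong term (toℕ-fromℕ n)) (cong (λ m → + m * u n) (k>n⇒nCk≡0 (n<1+n n)))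

  ∂-⋆ : ∀ f g n → ∂ (f ⋆ g) n ≡ (∂ f ⋆ g) n + (f ⋆ ∂ g) n
  ∂-⋆ f g n = begin
    ∂ (f ⋆ g) n
      ≡⟨⟩
    head + sum (⋆-summand f g (suc n) ∘ suc)
      ≡⟨ cong (λ s → head + s) pascal ⟩
    head + ((∂ f ⋆ g) n + sum rest)
      ≡⟨ x∙yz≈y∙xz head ((∂ f ⋆ g) n) (sum rest) ⟩
    (∂ f ⋆ g) n + (head + sum rest)
      ≡⟨ cong (λ s → (∂ f ⋆ g) n + (head + s)) drop-last ⟩
    (∂ f ⋆ g) n + (f ⋆ ∂ g) n
      ∎
    where
    head : ℤ
    head = + 1 * (f 0 * g (suc n))
    term : ℕ → ℤ
    term k = f (suc k) * g (n ∸ k)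
    rest : Vector ℤ (suc n)
    rest k = + (n C suc (toℕ k)) * term (toℕ k)
    pascal-summand : ∀ k → + (suc n C suc k) * term k ≡ + (n C k) * term k + + (n C suc k) * term k
    pascal-summand k = begin
      + (suc n C suc k) * term k                   ≡⟨ cong (λ m → + m * term k) (nCk+nC[k+1]≡[n+1]C[k+1] n k) ⟨
      + (n C k ℕ.+ n C suc k) * term k             ≡⟨ cong (_* term k) (pos-+ (n C k) (n C suc k)) ⟩
      (+ (n C k) + + (n C suc k)) * term k         ≡⟨ *-distribʳ-+ (term k) (+ (n C k)) (+ (n C suc k)) ⟩
      + (n C k) * term k + + (n C suc k) * term k  ∎
    pascal : sum (⋆-summand f g (suc n) ∘ suc) ≡ (∂ f ⋆ g) n + sum rest
    pascal = trans (sum-cong-≗ {suc n} {⋆-summand f g (suc n) ∘ suc} {λ k → ⋆-summand (∂ f) g n k + rest k}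
                                (pascal-summand ∘ toℕ))
                   (∑-distrib-+ (⋆-summand (∂ f) g n) rest)
    reindex : ∀ (k : Fin n) → + (n C suc (toℕ k)) * term (toℕ k) ≡ ⋆-summand f (∂ g) n (suc k)
    reindex k = cong (λ m → + (n C suc (toℕ k)) * (f (suc (toℕ k)) * g m)) (+-∸-assoc 1 (toℕ<n k))
    drop-last : sum rest ≡ sum (⋆-summand f (∂ g) n ∘ suc)
    drop-last = trans (∑-C-suc-drop-last n term) (sum-cong-≗ reindex)

  ∂³-⋆ : ∀ f g n →
    ∂³ (f ⋆ g) n ≡
    (∂³ f ⋆ g) n + + 3 * (∂ (∂ f) ⋆ ∂ g) n + + 3 * (∂ f ⋆ ∂ (∂ g)) n + (f ⋆ ∂³ g) n
  ∂³-⋆ f g n = begin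
    ∂³ (f ⋆ g) n
      ≡⟨ ∂-⋆ f g (2 ℕ.+ n) ⟩
    (∂ f ⋆ g) (2 ℕ.+ n) + (f ⋆ ∂ g) (2 ℕ.+ n)
      ≡⟨ cong₂ _+_ (∂-⋆ (∂ f) g (suc n)) (∂-⋆ f (∂ g) (suc n)) ⟩
    ((∂ (∂ f) ⋆ g) (suc n) + (∂ f ⋆ ∂ g) (suc n)) + ((∂ f ⋆ ∂ g) (suc n) + (f ⋆ ∂ (∂ g)) (suc n))
      ≡⟨ cong₂ _+_ (cong₂ _+_ (∂-⋆ (∂ (∂ f)) g n) (∂-⋆ (∂ f) (∂ g) n))
                   (cong₂ _+_ (∂-⋆ (∂ f) (∂ g) n) (∂-⋆ f (∂ (∂ g)) n)) ⟩
    ((p + q) + (q + r)) + ((q + r) + (r + s))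
      ≡⟨ collect p q r s ⟩
    p + + 3 * q + + 3 * r + s
      ∎
    where
    p q r s : ℤ
    p = (∂³ f ⋆ g) n
    q = (∂ (∂ f) ⋆ ∂ g) n
    r = (∂ f ⋆ ∂ (∂ g)) n
    s = (f ⋆ ∂³ g) n
    collect : ∀ p q r s → ((p + q) + (q + r)) + ((q + r) + (r + s)) ≡ p + + 3 * q + + 3 * r + s
    collect = solve-∀

  ⋆-periodic-antiperiodic : ∀ {f g} → ∂³ f ≗ f → ∂³ g ≗ -_ ∘ g →
    ∀ n → ∂³ (f ⋆ g) n ≡ + 3 * ((∂ (∂ f) ⋆ ∂ g) n + (∂ f ⋆ ∂ (∂ g)) n)
  ⋆-periodic-antiperiodic {f} {g} f-per g-anti n = begin
    ∂³ (f ⋆ g) n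
      ≡⟨ ∂³-⋆ f g n ⟩
    (∂³ f ⋆ g) n + + 3 * q + + 3 * r + (f ⋆ ∂³ g) n
      ≡⟨ cong₂ (λ x y → x + + 3 * q + + 3 * r + y) ∂³f⋆g f⋆∂³g ⟩
    (f ⋆ g) n + + 3 * q + + 3 * r + - (f ⋆ g) n
      ≡⟨ cancel ((f ⋆ g) n) q r ⟩
    + 3 * (q + r)
      ∎
    where
    q r : ℤ
    q = (∂ (∂ f) ⋆ ∂ g) n
    r = (∂ f ⋆ ∂ (∂ g)) n
    ∂³f⋆g : (∂³ f ⋆ g) n ≡ (f ⋆ g) n
    ∂³f⋆g = ⋆-cong {∂³ f} {f} {g} {g} f-per (λ _ → refl) n
    f⋆∂³g : (f ⋆ ∂³ g) n ≡ - (f ⋆ g) n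
    f⋆∂³g = trans (⋆-cong {f} {f} {∂³ g} { -_ ∘ g} (λ _ → refl) g-anti n) (⋆-negʳ f g n)
    cancel : ∀ p q r → p + + 3 * q + + 3 * r + - p ≡ + 3 * (q + r)
    cancel = solve-∀

  9∣⋆-periodic-antiperiodic : ∀ {f g} → ∂³ f ≗ f → ∂³ g ≗ -_ ∘ g →
    ∀ n → + 9 ∣ ∂³ (∂³ (f ⋆ g)) n
  9∣⋆-periodic-antiperiodic {f} {g} f-per g-anti n = divides (q + r) (begin
    ∂³ (∂³ (f ⋆ g)) n
      ≡⟨ ⋆-periodic-antiperiodic {f} {g} f-per g-anti (3 ℕ.+ n) ⟩
    + 3 * (∂³ (∂ (∂ f) ⋆ ∂ g) n + ∂³ (∂ f ⋆ ∂ (∂ g)) n)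
      ≡⟨ cong (λ x → + 3 * x) (cong₂ _+_
           (⋆-periodic-antiperiodic {∂ (∂ f)} {∂ g} (f-per ∘ (2 ℕ.+_)) (g-anti ∘ (1 ℕ.+_)) n)
           (⋆-periodic-antiperiodic {∂ f} {∂ (∂ g)} (f-per ∘ (1 ℕ.+_)) (g-anti ∘ (2 ℕ.+_)) n)) ⟩
    + 3 * (+ 3 * q + + 3 * r)
      ≡⟨ nine q r ⟩
    (q + r) * + 9
      ∎)
    where
    q r : ℤ
    q = (∂ (∂³ f) ⋆ ∂ (∂ g)) n + (∂³ f ⋆ ∂³ g) n
    r = (∂³ f ⋆ ∂³ g) n + (∂ (∂ f) ⋆ ∂ (∂³ g)) n
    nine : ∀ q r → + 3 * (+ 3 * q + + 3 * r) ≡ (q + r) * + 9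
    nine = solve-∀

  ∣-sum : ∀ {d n} (t : Vector ℤ n) → (∀ k → d ∣ t k) → d ∣ sum t
  ∣-sum {n = zero}  t d∣t = divides 0ℤ refl
  ∣-sum {n = suc n} t d∣t = ∣m∣n⇒∣m+n (d∣t zero) (∣-sum (t ∘ suc) (d∣t ∘ suc))

  -- Since f 0 = 1, (f ⋆ x) n is x n plus a combination of x 0, …, x (n ∸ 1).
  ⋆-unitˡ-reflects-∣ : ∀ {d} f x → f 0 ≡ + 1 → (∀ n → d ∣ (f ⋆ x) n) → ∀ n → d ∣ x n
  ⋆-unitˡ-reflects-∣ {d} f x f₀≡1 d∣f⋆x = <-rec (λ n → d ∣ x n) step
    where
    leading : ∀ n → + 1 * (f 0 * x n) ≡ x n
    leading n = trans (*-identityˡ _) (trans (cong (_* x n) f₀≡1) (*-identityˡ (x n)))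
    step : ∀ n → (∀ {m} → m < n → d ∣ x m) → d ∣ x n
    step n ih = subst (d ∣_) (leading n) (∣m+n∣n⇒∣m (d∣f⋆x n) (∣-sum _ λ k →
      ∣n⇒∣m*n (+ (n C suc (toℕ k))) (∣n⇒∣m*n (f (suc (toℕ k))) (ih (∸-monoʳ-< z<s (toℕ<n k))))))

module Congruence where

  open import Data.Bool.Base using (if_then_else_)
  open import Data.Integer.Base using (ℤ; +_; -_; _+_; _*_; _-_; _^_; 0ℤ; 1ℤ; -1ℤ)
  open import Data.Integer.Properties using (+-*-semiring; *-assoc; -1*i≡-i)
  open import Data.Integer.Divisibility.Signed using (_∣_; divides; ∣m∣n⇒∣m-n)
  open import Data.Integer.Tactic.RingSolver using (solve-∀)
  open import Data.Nat.DivMod using (_%_; [m+n]%n≡m%n)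
  open import Data.Nat.Properties using (+-comm; *-suc)
  open import Algebra.Properties.Semiring.Sum +-*-semiring using (sum; sum-cong-≗)
  open BinomialConvolution
  open ≡-Reasoning

  χ₃ : ℕ → ℤ
  χ₃ k = if k % 3 ℕ.≡ᵇ 0 then 1ℤ else 0ℤ

  -- χ₃⁻ k = (-1)ᵏ χ₃ k, so the exponential generating function of χ₃⁻ is C(-t).
  χ₃⁻ : ℕ → ℤ
  χ₃⁻ 0 = 1ℤ
  χ₃⁻ 1 = 0ℤ
  χ₃⁻ 2 = 0ℤ
  χ₃⁻ (suc (suc (suc k))) = - χ₃⁻ k

  ∂³χ₃≗χ₃ : ∂³ χ₃ ≗ χ₃
  ∂³χ₃≗χ₃ k = cong (λ r → if r ℕ.≡ᵇ 0 then 1ℤ else 0ℤ)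
                   (trans (cong (_% 3) (+-comm 3 k)) ([m+n]%n≡m%n k 3))

  χ₃⁻[3*n] : ∀ n → χ₃⁻ (3 ℕ.* n) ≡ -1ℤ ^ n
  χ₃⁻[3*n] zero    = refl
  χ₃⁻[3*n] (suc n) = begin
    χ₃⁻ (3 ℕ.* suc n)  ≡⟨ cong χ₃⁻ (*-suc 3 n) ⟩
    - χ₃⁻ (3 ℕ.* n)    ≡⟨ cong -_ (χ₃⁻[3*n] n) ⟩
    - (-1ℤ ^ n)        ≡⟨ -1*i≡-i (-1ℤ ^ n) ⟨
    -1ℤ ^ suc n        ∎

  9∣χ₃⋆χ₃⁻ : ∀ n → + 9 ∣ (χ₃ ⋆ χ₃⁻) (suc n)
  9∣χ₃⋆χ₃⁻ 0 = divides 0ℤ refl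
  9∣χ₃⋆χ₃⁻ 1 = divides 0ℤ refl
  9∣χ₃⋆χ₃⁻ 2 = divides 0ℤ refl
  9∣χ₃⋆χ₃⁻ 3 = divides 0ℤ refl
  9∣χ₃⋆χ₃⁻ 4 = divides 0ℤ refl
  9∣χ₃⋆χ₃⁻ (suc (suc (suc (suc (suc n))))) =
    9∣⋆-periodic-antiperiodic {χ₃} {χ₃⁻} ∂³χ₃≗χ₃ (λ _ → refl) n

  wHistory : ℕ → List ℤ
  wHistory zero    = 1ℤ ∷ []
  wHistory (suc n) =
    - foldr _+_ 0ℤ (zipWith _*_ (applyUpTo (λ i → + (suc n C suc i) * χ₃ (suc i)) (suc n)) (wHistory n))
    ∷ wHistory n

  w : ℕ → ℤ
  w n with wHistory n
  ... | x ∷ _ = x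
  ... | []    = 0ℤ

  wHistory≡applyDownFrom : ∀ n → wHistory n ≡ applyDownFrom w (suc n)
  wHistory≡applyDownFrom zero    = refl
  wHistory≡applyDownFrom (suc n) = cong (w (suc n) ∷_) (wHistory≡applyDownFrom n)

  w-suc : ∀ n → w (suc n) ≡ - sum (⋆-summand χ₃ w (suc n) ∘ suc)
  w-suc n = cong -_ (begin
    foldr _+_ 0ℤ (zipWith _*_ (applyUpTo coeff (suc n)) (wHistory n))
      ≡⟨ cong (λ ws → foldr _+_ 0ℤ (zipWith _*_ (applyUpTo coeff (suc n)) ws))
              (wHistory≡applyDownFrom n) ⟩
    foldr _+_ 0ℤ (zipWith _*_ (applyUpTo coeff (suc n)) (applyDownFrom w (suc n)))
      ≡⟨ foldr-zipWith-applyUpTo-applyDownFrom +-*-semiring coeff w (suc n) ⟩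
    sum {suc n} (λ k → coeff (toℕ k) * w (n ∸ toℕ k))
      ≡⟨ sum-cong-≗ {suc n} {λ k → coeff (toℕ k) * w (n ∸ toℕ k)} {⋆-summand χ₃ w (suc n) ∘ suc}
                    reassoc ⟩
    sum (⋆-summand χ₃ w (suc n) ∘ suc)
      ∎)
    where
    coeff : ℕ → ℤ
    coeff i = + (suc n C suc i) * χ₃ (suc i)
    reassoc : ∀ k → coeff (toℕ k) * w (n ∸ toℕ k) ≡ ⋆-summand χ₃ w (suc n) (suc k)
    reassoc k = *-assoc (+ (suc n C suc (toℕ k))) (χ₃ (suc (toℕ k))) (w (n ∸ toℕ k))

  χ₃⋆w[suc]≡0 : ∀ n → (χ₃ ⋆ w) (suc n) ≡ 0ℤ
  χ₃⋆w[suc]≡0 n = begin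
    (χ₃ ⋆ w) (suc n)                ≡⟨⟩
    + 1 * (1ℤ * w (suc n)) + rest   ≡⟨ cong (λ x → + 1 * (1ℤ * x) + rest) (w-suc n) ⟩
    + 1 * (1ℤ * - rest) + rest      ≡⟨ cancel rest ⟩
    0ℤ                              ∎
    where
    rest : ℤ
    rest = sum (⋆-summand χ₃ w (suc n) ∘ suc)
    cancel : ∀ x → + 1 * (1ℤ * - x) + x ≡ 0ℤ
    cancel = solve-∀

  9∣χ₃⋆[w-χ₃⁻] : ∀ n → + 9 ∣ (χ₃ ⋆ (λ k → w k - χ₃⁻ k)) n
  9∣χ₃⋆[w-χ₃⁻] zero    = divides 0ℤ refl
  9∣χ₃⋆[w-χ₃⁻] (suc n) rewrite ⋆-minusʳ χ₃ w χ₃⁻ (suc n) | χ₃⋆w[suc]≡0 n =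
    ∣m∣n⇒∣m-n (divides 0ℤ refl) (9∣χ₃⋆χ₃⁻ n)

  9∣w-χ₃⁻ : ∀ n → + 9 ∣ w n - χ₃⁻ n
  9∣w-χ₃⁻ = ⋆-unitˡ-reflects-∣ χ₃ (λ k → w k - χ₃⁻ k) refl 9∣χ₃⋆[w-χ₃⁻]

module Integrality where

  open import Data.Integer.Base as ℤ using (ℤ; +_)
  import Data.Integer.Properties as ℤ
  open import Data.Rational.Base using (ℚ; _+_; _*_; -_; 0ℚ; 1ℚ; _/_; toℚᵘ)
  open import Data.Rational.Properties
    using ( +-*-ring; toℚᵘ-injective; toℚᵘ-fromℚᵘ; toℚᵘ-homo-+; toℚᵘ-homo-*; toℚᵘ-homo‿-
          ; *-zeroʳ; neg-distribʳ-*)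
  import Data.Rational.Unnormalised.Base as ℚᵘ
  import Data.Rational.Unnormalised.Properties as ℚᵘ
  open import Data.Rational.Solver using (module +-*-Solver)
  open import Data.Integer.Tactic.RingSolver using (solve-∀)
  open import Data.Nat.DivMod using (_%_; m/n*n≡m)
  open import Data.Nat.Combinatorics using (nCk≡n!/k![n-k]!; k![n∸k]!∣n!)
  open import Data.Nat.Properties using (m∸n≤m; *-identityˡ; _!≢0; _!*_!≢0)
  open import Algebra.Properties.Semiring.Sum (Ring.semiring +-*-ring) using (sum; sum-cong-≗; *-distribˡ-sum)
  import Algebra.Properties.Semiring.Sum ℤ.+-*-semiring as ℤ∑
  open BinomialConvolution using (⋆-summand)
  open Congruence using (χ₃; w; w-suc)
  open ≡-Reasoning

  ι : ℤ → ℚ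
  ι i = i / 1

  -- ι i is fromℚᵘ (mkℚᵘ i 0), so its algebraic properties can be checked in ℚᵘ.
  toℚᵘ-ι : ∀ i → toℚᵘ (ι i) ℚᵘ.≃ ℚᵘ.mkℚᵘ i 0
  toℚᵘ-ι i = toℚᵘ-fromℚᵘ (ℚᵘ.mkℚᵘ i 0)

  toℚᵘ≃⇒ι≡ : ∀ i {x} → toℚᵘ x ℚᵘ.≃ ℚᵘ.mkℚᵘ i 0 → ι i ≡ x
  toℚᵘ≃⇒ι≡ i x≃i = toℚᵘ-injective (ℚᵘ.≃-trans (toℚᵘ-ι i) (ℚᵘ.≃-sym x≃i))

  ι-homo-+ : ∀ i j → ι (i ℤ.+ j) ≡ ι i + ι j
  ι-homo-+ i j = toℚᵘ≃⇒ι≡ (i ℤ.+ j) (ℚᵘ.≃-trans (toℚᵘ-homo-+ (ι i) (ι j))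
    (ℚᵘ.≃-trans (ℚᵘ.+-cong (toℚᵘ-ι i) (toℚᵘ-ι j)) (ℚᵘ.*≡* (cross i j))))
    where
    cross : ∀ i j → (i ℤ.* + 1 ℤ.+ j ℤ.* + 1) ℤ.* + 1 ≡ (i ℤ.+ j) ℤ.* + 1
    cross = solve-∀

  ι-homo-* : ∀ i j → ι (i ℤ.* j) ≡ ι i * ι j
  ι-homo-* i j = toℚᵘ≃⇒ι≡ (i ℤ.* j) (ℚᵘ.≃-trans (toℚᵘ-homo-* (ι i) (ι j))
    (ℚᵘ.≃-trans (ℚᵘ.*-cong (toℚᵘ-ι i) (toℚᵘ-ι j)) (ℚᵘ.*≡* refl)))

  ι-homo‿- : ∀ i → ι (ℤ.- i) ≡ - ι i
  ι-homo‿- i =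
    toℚᵘ≃⇒ι≡ (ℤ.- i) (ℚᵘ.≃-trans (toℚᵘ-homo‿- (ι i)) (ℚᵘ.-‿cong (toℚᵘ-ι i)))

  ι-homo-sum : ∀ {n} (t : Vector ℤ n) → ι (ℤ∑.sum t) ≡ sum (ι ∘ t)
  ι-homo-sum {zero}  t = refl
  ι-homo-sum {suc n} t = trans (ι-homo-+ (t zero) (ℤ∑.sum (t ∘ suc)))
                               (cong (λ s → ι (t zero) + s) (ι-homo-sum (t ∘ suc)))

  ι[n]*1/n≡1 : ∀ n .{{_ : ℕ.NonZero n}} → ι (+ n) * (+ 1 / n) ≡ 1ℚ
  ι[n]*1/n≡1 (suc n) = sym (toℚᵘ≃⇒ι≡ (+ 1) (ℚᵘ.≃-trans (toℚᵘ-homo-* (ι (+ suc n)) (+ 1 / suc n))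
    (ℚᵘ.≃-trans (ℚᵘ.*-cong (toℚᵘ-ι (+ suc n)) (toℚᵘ-fromℚᵘ (ℚᵘ.mkℚᵘ (+ 1) n)))
                (ℚᵘ.*≡* cross))))
    where
    cross : (+ suc n ℤ.* + 1) ℤ.* + 1 ≡ + 1 ℤ.* + (1 ℕ.* suc n)
    cross = begin
      (+ suc n ℤ.* + 1) ℤ.* + 1  ≡⟨ ℤ.*-identityʳ _ ⟩
      + suc n ℤ.* + 1            ≡⟨ ℤ.*-identityʳ _ ⟩
      + suc n                    ≡⟨ cong +_ (*-identityˡ (suc n)) ⟨
      + (1 ℕ.* suc n)            ≡⟨ ℤ.*-identityˡ _ ⟨
      + 1 ℤ.* + (1 ℕ.* suc n)    ∎

  k!*c≡χ₃ : ∀ k → ι (+ (k !)) * c k ≡ ι (χ₃ k)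
  k!*c≡χ₃ k with k % 3
  ... | zero  = ι[n]*1/n≡1 (k !) {{k !≢0}}
  ... | suc _ = *-zeroʳ (ι (+ (k !)))

  invList≡applyDownFrom : ∀ n → invList n ≡ applyDownFrom a (suc n)
  invList≡applyDownFrom zero    = refl
  invList≡applyDownFrom (suc n) = cong (a (suc n) ∷_) (invList≡applyDownFrom n)

  a-suc : ∀ n → a (suc n) ≡ - sum {suc n} (λ k → c (suc (toℕ k)) * a (n ∸ toℕ k))
  a-suc n = cong -_ (begin
    foldr _+_ 0ℚ (zipWith _*_ (applyUpTo (c ∘ suc) (suc n)) (invList n))
      ≡⟨ cong (λ as → foldr _+_ 0ℚ (zipWith _*_ (applyUpTo (c ∘ suc) (suc n)) as))
              (invList≡applyDownFrom n) ⟩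
    foldr _+_ 0ℚ (zipWith _*_ (applyUpTo (c ∘ suc) (suc n)) (applyDownFrom a (suc n)))
      ≡⟨ foldr-zipWith-applyUpTo-applyDownFrom (Ring.semiring +-*-ring) (c ∘ suc) a (suc n) ⟩
    sum {suc n} (λ k → c (suc (toℕ k)) * a (n ∸ toℕ k))
      ∎)

  n!≡nCk*k!*[n∸k]! : ∀ {n k} → k ℕ.≤ n → n ! ≡ (n C k) ℕ.* (k ! ℕ.* (n ∸ k) !)
  n!≡nCk*k!*[n∸k]! {n} {k} k≤n = sym (trans (cong (ℕ._* (k ! ℕ.* (n ∸ k) !)) (nCk≡n!/k![n-k]! k≤n))
                                             (m/n*n≡m {{k !* (n ∸ k) !≢0}} (k![n∸k]!∣n! k≤n)))

  ι-summand : ∀ n (ih : ∀ {m} → m < suc n → W m ≡ ι (w m)) k → k ℕ.≤ n →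
    ι (+ (suc n !)) * (c (suc k) * a (n ∸ k)) ≡ ι (+ (suc n C suc k) ℤ.* (χ₃ (suc k) ℤ.* w (n ∸ k)))
  ι-summand n ih k k≤n = begin
    ι (+ (suc n !)) * (c (suc k) * a (n ∸ k))
      ≡⟨ cong (λ m → ι (+ m) * (c (suc k) * a (n ∸ k))) (n!≡nCk*k!*[n∸k]! (ℕ.s≤s k≤n)) ⟩
    ι (+ (N ℕ.* (suc k ! ℕ.* (n ∸ k) !))) * (c (suc k) * a (n ∸ k))
      ≡⟨ cong (_* (c (suc k) * a (n ∸ k))) ι-factorials ⟩
    (ι (+ N) * (ι (+ (suc k !)) * ι (+ ((n ∸ k) !)))) * (c (suc k) * a (n ∸ k))
      ≡⟨ regroup (ι (+ N)) (ι (+ (suc k !))) (ι (+ ((n ∸ k) !))) (c (suc k)) (a (n ∸ k)) ⟩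
    ι (+ N) * ((ι (+ (suc k !)) * c (suc k)) * W (n ∸ k))
      ≡⟨ cong₂ (λ x y → ι (+ N) * (x * y)) (k!*c≡χ₃ (suc k)) (ih (ℕ.s≤s (m∸n≤m n k))) ⟩
    ι (+ N) * (ι (χ₃ (suc k)) * ι (w (n ∸ k)))
      ≡⟨ trans (ι-homo-* (+ N) _) (cong (ι (+ N) *_) (ι-homo-* (χ₃ (suc k)) (w (n ∸ k)))) ⟨
    ι (+ N ℤ.* (χ₃ (suc k) ℤ.* w (n ∸ k)))
      ∎
    where
    N : ℕ
    N = suc n C suc k
    ι-factorials : ι (+ (N ℕ.* (suc k ! ℕ.* (n ∸ k) !))) ≡ ι (+ N) * (ι (+ (suc k !)) * ι (+ ((n ∸ k) !)))
    ι-factorials = begin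
      ι (+ (N ℕ.* (suc k ! ℕ.* (n ∸ k) !)))
        ≡⟨ cong ι (ℤ.pos-* N _) ⟩
      ι (+ N ℤ.* + (suc k ! ℕ.* (n ∸ k) !))
        ≡⟨ ι-homo-* (+ N) _ ⟩
      ι (+ N) * ι (+ (suc k ! ℕ.* (n ∸ k) !))
        ≡⟨ cong (λ x → ι (+ N) * ι x) (ℤ.pos-* (suc k !) ((n ∸ k) !)) ⟩
      ι (+ N) * ι (+ (suc k !) ℤ.* + ((n ∸ k) !))
        ≡⟨ cong (ι (+ N) *_) (ι-homo-* (+ (suc k !)) (+ ((n ∸ k) !))) ⟩
      ι (+ N) * (ι (+ (suc k !)) * ι (+ ((n ∸ k) !)))
        ∎
    regroup : ∀ x y z p q → (x * (y * z)) * (p * q) ≡ x * ((y * p) * (z * q))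
    regroup = solve 5 (λ x y z p q → (x :* (y :* z)) :* (p :* q) := x :* ((y :* p) :* (z :* q))) refl
      where open +-*-Solver

  W≡ι∘w : ∀ n → W n ≡ ι (w n)
  W≡ι∘w = <-rec (λ n → W n ≡ ι (w n)) step
    where
    step : ∀ n → (∀ {m} → m < n → W m ≡ ι (w m)) → W n ≡ ι (w n)
    step zero    _  = refl
    step (suc n) ih = begin
      ι (+ (suc n !)) * a (suc n)             ≡⟨ cong (ι (+ (suc n !)) *_) (a-suc n) ⟩
      ι (+ (suc n !)) * - sum qs              ≡⟨ neg-distribʳ-* (ι (+ (suc n !))) (sum qs) ⟨
      - (ι (+ (suc n !)) * sum qs)            ≡⟨ cong -_ (*-distribˡ-sum (ι (+ (suc n !))) qs) ⟩
      - sum (λ k → ι (+ (suc n !)) * qs k)    ≡⟨ cong -_ (sum-cong-≗ {suc n} {_} {ι ∘ zs} summands) ⟩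
      - sum (ι ∘ zs)                          ≡⟨ cong -_ (ι-homo-sum zs) ⟨
      - ι (ℤ∑.sum zs)                         ≡⟨ ι-homo‿- (ℤ∑.sum zs) ⟨
      ι (ℤ.- ℤ∑.sum zs)                       ≡⟨ cong ι (w-suc n) ⟨
      ι (w (suc n))                           ∎
      where
      qs : Vector ℚ (suc n)
      qs k = c (suc (toℕ k)) * a (n ∸ toℕ k)
      zs : Vector ℤ (suc n)
      zs = ⋆-summand χ₃ w (suc n) ∘ suc
      summands : ∀ k → ι (+ (suc n !)) * qs k ≡ ι (zs k)
      summands k = ι-summand n ih (toℕ k) (ℕ.s≤s⁻¹ (toℕ<n k))

open Congruence using (w; χ₃⁻[3*n]; 9∣w-χ₃⁻)
open Integrality using (W≡ι∘w)
open import Data.Integer.Divisibility.Signed as Signed using (∣⇒∣ᵤ)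

open import Data.Nat using (ℕ; _*_)
open import Data.Integer using (+_; -[1+_]; _-_; _^_)
open import Data.Integer.Divisibility using (_∣_)
open import Data.Rational using (_/_)
open import Data.Product using (∃-syntax; _×_; _,_)

theorem3 : ∀ (n : ℕ) → ∃[ k ] ((W (3 * n) ≡ k / 1) × (+ 9 ∣ (k - (-[1+ 0 ] ^ n))))
theorem3 n = w (3 * n) , W≡ι∘w (3 * n) , ∣⇒∣ᵤ 9∣w[3n]-[-1]ⁿ
  where
  9∣w[3n]-[-1]ⁿ : + 9 Signed.∣ w (3 * n) - -[1+ 0 ] ^ n
  9∣w[3n]-[-1]ⁿ = subst (λ e → + 9 Signed.∣ w (3 * n) - e) (χ₃⁻[3*n] n) (9∣w-χ₃⁻ (3 * n))
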